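{- Let $\mathfrak X$ be a ternary coherent configuration on a finite set $\Omega$ that is invariant with respect to a $2$-transitive group $G\le\mathrm{Sym}(\Omega)$. Then every class of $\mathfrak X$ whose triples do not have pairwise distinct entries is an orbit of $G$ in its componentwise action on $\Omega^3$; i.e., $\mathfrak X\setminus\mathfrak X^*\subseteq\mathrm{Orb}_3(G)$, where $\mathfrak X^*$ is the set of classes consisting of triples with pairwise distinct entries.
   Context: Ternary coherent configuration: for $M=\{1,2,3\}$, a partition $\mathfrak X$ of $\Omega^3$ such that for every class $X$: (C1) the equivalence relation $\rho(x)$ on $M$ ($i\sim j$ iff $x_i=x_j$) is the same for all $x\in X$; (C2) $X^\sigma=\{(x_{1^\sigma},x_{2^\sigma},x_{3^\sigma}):x\in X\}\in\mathfrak X$ for every map $\sigma:M\to M$; (C3) for any classes $X_1,X_2,X_3$ the number of $\alpha\in\Omega$ such that the triple obtained from $x$ by replacing its $i$th coordinate with $\alpha$ lies in $X_i$ for all $i$, is independent of $x\in X$. $\mathfrak X$ is invariant with respect to $G$ if $X^f=X$ for all classes $X$ and all $f\in G$ (componentwise action). $\mathrm{Orb}_3(G)$ is the set of orbits of $G$ on $\Omega^3$ under the componentwise action. -}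

module Defs where

open import Data.Nat using (ℕ)
open import Data.Fin using (Fin; zero; suc; _≟_)
open import Data.Fin.Permutation using (Permutation′; _⟨$⟩ʳ_; id; flip; _∘ₚ_)
open import Data.Vec using (Vec; lookup; tabulate; map; _[_]≔_)
open import Data.List using (List; filter; length)
open import Data.List.Base using (allFin)
open import Data.Product using (Σ; _×_; _,_; ∃)
open import Data.Sum using (_⊎_)
open import Relation.Binary.PropositionalEquality using (_≡_; _≢_)
open import Relation.Nullary using (¬_; Dec; yes; no)
open import Relation.Nullary.Decidable using (_×-dec_)
open import Function.Bundles using (_⇔_)

-- M = {1,2,3} is modelled by Fin 3; Ω by Fin n; Ω³ by Vec (Fin n) 3.
Triple : ℕ → Set
Triple n = Vec (Fin n) 3

_^_ : ∀ {n} → Triple n → (Fin 3 → Fin 3) → Triple n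
x ^ σ = tabulate (λ i → lookup x (σ i))

act : ∀ {n} → Permutation′ n → Triple n → Triple n
act g x = map (g ⟨$⟩ʳ_) x

-- A partition 𝔛 of Ω³ is given by a labelling  cls : Ω³ → Fin m ;
-- its classes are the (nonempty) fibres  { y | cls y ≡ cls x }.

count : ∀ {n m} → (Triple n → Fin m) → (Fin 3 → Fin m) → Triple n → ℕ
count {n} cls a x = length (filter P? (allFin n))
  where
  P? : (α : Fin n) → Dec ((cls (x [ zero ]≔ α) ≡ a zero)
                        × (cls (x [ suc zero ]≔ α) ≡ a (suc zero))
                        × (cls (x [ suc (suc zero) ]≔ α) ≡ a (suc (suc zero))))
  P? α = (cls (x [ zero ]≔ α) ≟ a zero)
         ×-dec ((cls (x [ suc zero ]≔ α) ≟ a (suc zero))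
         ×-dec (cls (x [ suc (suc zero) ]≔ α) ≟ a (suc (suc zero))))

record IsTernaryCC {n m : ℕ} (cls : Triple n → Fin m) : Set where
  field
    C1 : ∀ x y → cls x ≡ cls y → ∀ i j →
         (lookup x i ≡ lookup x j) ⇔ (lookup y i ≡ lookup y j)
    -- (C2) for every σ : M → M, X^σ is a class: X^σ ⊆ class of x^σ ...
    C2-sub : ∀ (σ : Fin 3 → Fin 3) x y → cls x ≡ cls y → cls (y ^ σ) ≡ cls (x ^ σ)
    -- ... and the class of x^σ is contained in X^σ
    C2-sup : ∀ (σ : Fin 3 → Fin 3) x z → cls z ≡ cls (x ^ σ) →
             ∃ λ y → cls y ≡ cls x × z ≡ y ^ σ
    C3 : ∀ (a : Fin 3 → Fin m) x y → cls x ≡ cls y → count cls a x ≡ count cls a y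

record IsPermGroup {n : ℕ} (G : Permutation′ n → Set) : Set where
  field
    id∈   : G id
    ∘∈    : ∀ {g h} → G g → G h → G (g ∘ₚ h)
    flip∈ : ∀ {g} → G g → G (flip g)

IsTwoTransitive : ∀ {n} → (Permutation′ n → Set) → Set
IsTwoTransitive {n} G = ∀ (a b c d : Fin n) → a ≢ b → c ≢ d →
  Σ (Permutation′ n) λ g → G g × (g ⟨$⟩ʳ a ≡ c) × (g ⟨$⟩ʳ b ≡ d)

IsInvariant : ∀ {n m} → (Permutation′ n → Set) → (Triple n → Fin m) → Set
IsInvariant {n} G cls = ∀ g → G g →
  (∀ x → cls (act g x) ≡ cls x) × (∀ y → ∃ λ x → cls x ≡ cls y × act g x ≡ y)

HasRepeat : ∀ {n} → Triple n → Set
HasRepeat x = (lookup x zero ≡ lookup x (suc zero))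
            ⊎ (lookup x zero ≡ lookup x (suc (suc zero)))
            ⊎ (lookup x (suc zero) ≡ lookup x (suc (suc zero)))

ClassIsOrbit : ∀ {n m} → (Permutation′ n → Set) → (Triple n → Fin m) → Triple n → Set
ClassIsOrbit {n} G cls x = ∀ y →
  (cls y ≡ cls x) ⇔ (Σ (Permutation′ n) λ g → G g × act g x ≡ y)

-- A triple with a repeated entry is determined by two of its entries together with
-- its equality pattern.  By (C1) all triples of a class share that pattern, and a
-- 2-transitive group can send any pair of entries to any pair with the same pattern,
-- so it moves a triple with a repeat onto every triple of its class.

module Submission where

open import Defs
open import Data.Nat using (ℕ)
open import Data.Fin using (Fin; zero; suc; _≟_)
open import Data.Fin.Permutation using (Permutation′; _⟨$⟩ʳ_; id)
open import Data.Vec using (Vec; lookup; map; _∷_; [])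
open import Data.Vec.Properties using (lookup-map)
open import Data.Vec.Relation.Binary.Pointwise.Extensional using (ext; Pointwise-≡⇒≡)
open import Data.Product using (Σ; ∃₂; _×_; _,_; proj₁)
open import Data.Sum using (_⊎_; inj₁; inj₂)
open import Relation.Binary.PropositionalEquality using (_≡_; refl; sym; trans; cong)
open import Relation.Nullary using (yes; no)
open import Function.Bundles using (_⇔_; mk⇔; Equivalence)

Spans : ∀ {a} {A : Set a} {k} → Fin k → Fin k → Vec A k → Set a
Spans i j x = ∀ l → lookup x l ≡ lookup x i ⊎ lookup x l ≡ lookup x j

SameEqualityPattern : ∀ {a} {A : Set a} {k} → Vec A k → Vec A k → Set a
SameEqualityPattern x y = ∀ i j → (lookup x i ≡ lookup x j) ⇔ (lookup y i ≡ lookup y j)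

repeat⇒spans : ∀ {n} (x : Triple n) → HasRepeat x → ∃₂ λ i j → Spans i j x
repeat⇒spans (_ ∷ _ ∷ _ ∷ []) (inj₁ x₀≡x₁) = zero , suc (suc zero) , λ
  { zero → inj₁ refl ; (suc zero) → inj₁ (sym x₀≡x₁) ; (suc (suc zero)) → inj₂ refl }
repeat⇒spans (_ ∷ _ ∷ _ ∷ []) (inj₂ (inj₁ x₀≡x₂)) = zero , suc zero , λ
  { zero → inj₁ refl ; (suc zero) → inj₂ refl ; (suc (suc zero)) → inj₁ (sym x₀≡x₂) }
repeat⇒spans (_ ∷ _ ∷ _ ∷ []) (inj₂ (inj₂ x₁≡x₂)) = zero , suc zero , λ
  { zero → inj₁ refl ; (suc zero) → inj₂ refl ; (suc (suc zero)) → inj₂ (sym x₁≡x₂) }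

map-≡-pointwise : ∀ {n k} (g : Permutation′ n) {x y : Vec (Fin n) k} →
  (∀ l → g ⟨$⟩ʳ lookup x l ≡ lookup y l) → map (g ⟨$⟩ʳ_) x ≡ y
map-≡-pointwise g {x} gx≡y = Pointwise-≡⇒≡ (ext λ l → trans (lookup-map l (g ⟨$⟩ʳ_) x) (gx≡y l))

module _ {n : ℕ} {G : Permutation′ n → Set} (G-group : IsPermGroup G)
         (G-2trans : IsTwoTransitive G) where

  open IsPermGroup G-group using (id∈)

  transitive : (a c : Fin n) → Σ (Permutation′ n) λ g → G g × g ⟨$⟩ʳ a ≡ c
  transitive a c with a ≟ c
  ... | yes a≡c = id , id∈ , a≡c
  ... | no a≢c with G-2trans a c c a a≢c (λ c≡a → a≢c (sym c≡a))
  ...   | g , g∈G , ga≡c , _ = g , g∈G , ga≡c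

  pair-transitive : (u v u′ v′ : Fin n) → (u ≡ v) ⇔ (u′ ≡ v′) →
    Σ (Permutation′ n) λ g → G g × g ⟨$⟩ʳ u ≡ u′ × g ⟨$⟩ʳ v ≡ v′
  pair-transitive u v u′ v′ same with u ≟ v
  ... | no u≢v = G-2trans u v u′ v′ u≢v (λ u′≡v′ → u≢v (Equivalence.from same u′≡v′))
  ... | yes refl with transitive u u′
  ...   | g , g∈G , gu≡u′ = g , g∈G , gu≡u′ , trans gu≡u′ (Equivalence.to same refl)

  spanned-orbit : ∀ {k i j} {x y : Vec (Fin n) k} → Spans i j x → SameEqualityPattern x y →
    Σ (Permutation′ n) λ g → G g × map (g ⟨$⟩ʳ_) x ≡ y
  spanned-orbit {i = i} {j} {x} {y} spans same
    with pair-transitive (lookup x i) (lookup x j) (lookup y i) (lookup y j) (same i j)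
  ... | g , g∈G , gxᵢ≡yᵢ , gxⱼ≡yⱼ = g , g∈G , map-≡-pointwise g moves
    where
    moves : ∀ l → g ⟨$⟩ʳ lookup x l ≡ lookup y l
    moves l with spans l
    ... | inj₁ xₗ≡xᵢ = trans (cong (g ⟨$⟩ʳ_) xₗ≡xᵢ) (trans gxᵢ≡yᵢ (sym (Equivalence.to (same l i) xₗ≡xᵢ)))
    ... | inj₂ xₗ≡xⱼ = trans (cong (g ⟨$⟩ʳ_) xₗ≡xⱼ) (trans gxⱼ≡yⱼ (sym (Equivalence.to (same l j) xₗ≡xⱼ)))

lemma5p4 : ∀ {n m : ℕ} (cls : Triple n → Fin m) (G : Permutation′ n → Set) →
    IsTernaryCC cls → IsPermGroup G → IsTwoTransitive G → IsInvariant G cls →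
    ∀ x → HasRepeat x → ClassIsOrbit G cls x
lemma5p4 {n} cls G CC G-group G-2trans G-invariant x x-repeats y = mk⇔ class⇒orbit orbit⇒class
  where
  open IsTernaryCC CC using (C1)

  class⇒orbit : cls y ≡ cls x → Σ (Permutation′ n) λ g → G g × act g x ≡ y
  class⇒orbit y∼x with repeat⇒spans x x-repeats
  ... | _ , _ , spans = spanned-orbit G-group G-2trans spans (C1 x y (sym y∼x))

  orbit⇒class : (Σ (Permutation′ n) λ g → G g × act g x ≡ y) → cls y ≡ cls x
  orbit⇒class (g , g∈G , refl) = proj₁ (G-invariant g g∈G) x
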